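{- Let $\mathcal{P}_\omega$ be the set of partitions $\lambda=(\lambda_1\ge\lambda_2\ge\cdots\ge\lambda_\ell)$ with parts in $\mathbb{Z}_{\ge0}$ (a part $0$ is allowed) such that the smallest part is unique, i.e. $\lambda_{\ell-1}>\lambda_\ell\ge0$, and every odd part $\lambda_i$ satisfies $\lambda_i\le 2\lambda_\ell+1$. For $\lambda=(\lambda_1,\dots,\lambda_\ell)\in\mathcal{P}_\omega$ with $\ell\ge2$ define $\psi^-(\lambda)$ by: (i) if $\lambda_\ell=0$ and $\lambda_{\ell-1}\ge 2$: $\psi^-(\lambda)=(\lambda_1,\dots,\lambda_{\ell-2},\lambda_{\ell-1}-1)$; (ii) if $\lambda_\ell\ge0$ and $\lambda_{\ell-1}=\lambda_\ell+1$: let $\mu$ be the nonincreasing rearrangement of $(\lambda_1,\dots,\lambda_{\ell-2},\lambda_{\ell-1}+\lambda_\ell)$, and let $\psi^-(\lambda)$ be $\mu$ with its last (smallest) part decreased by $1$; (iii) if $\lambda_\ell\ge1$ and $\lambda_{\ell-1}\ge\lambda_\ell+2$: $\psi^-(\lambda)$ is the nonincreasing rearrangement of $(\lambda_1-2,\dots,\lambda_{\ell-1}-2,\lambda_\ell-1)$. Then $|\lambda|-|\psi^-(\lambda)|$ is odd and $\psi^-(\lambda)\in\mathcal{P}_\omega$.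
   Context: $|\lambda|$ denotes the sum of the parts of $\lambda$. -}

module Defs where

open import Data.Nat using (ℕ; zero; suc; _+_; _*_; _∸_; _≤_; _<_; _≟_; _≤?_)
open import Data.Nat.Properties using (≤-decTotalOrder)
open import Data.Integer as ℤ using (ℤ)
open import Data.List using (List; []; _∷_; _++_; [_]; map; reverse; length)
open import Data.Nat.ListAction using (sum)
open import Data.List.Relation.Unary.All using (All)
open import Data.List.Relation.Unary.Linked using (Linked)
open import Data.List.Sort ≤-decTotalOrder using (sort)
open import Data.Product using (Σ; ∃; _×_; _,_)
open import Data.Bool using (if_then_else_; _∧_)
open import Relation.Nullary using (does)
open import Relation.Binary.PropositionalEquality using (_≡_)

OddNat : ℕ → Set
OddNat n = ∃ λ (k : ℕ) → n ≡ 1 + 2 * k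

OddInt : ℤ → Set
OddInt z = ∃ λ (k : ℤ) → z ≡ ℤ.1ℤ ℤ.+ (ℤ.+ 2) ℤ.* k

size : List ℕ → ℕ
size = sum

Pω : List ℕ → Set
Pω lam = Σ (List ℕ) λ pre → Σ ℕ λ m →
         (lam ≡ pre ++ [ m ])
       × Linked (λ x y → y ≤ x) lam
       × All (λ x → m < x) pre
       × All (λ x → OddNat x → x ≤ 2 * m + 1) lam

sortDesc : List ℕ → List ℕ
sortDesc xs = reverse (sort xs)

decLast : List ℕ → List ℕ
decLast [] = []
decLast (x ∷ []) = (x ∸ 1) ∷ []
decLast (x ∷ y ∷ xs) = x ∷ decLast (y ∷ xs)

-- ψ⁻ on λ = pre ++ [a , b], i.e. a = λ_{ℓ-1}, b = λ_ℓ.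
ψ-step : List ℕ → ℕ → ℕ → List ℕ
ψ-step pre a b =
  if does (b ≟ 0) ∧ does (2 ≤? a)
    then pre ++ [ a ∸ 1 ]
    else if does (a ≟ suc b)
      then decLast (sortDesc (pre ++ [ a + b ]))
      else if does (1 ≤? b) ∧ does (b + 2 ≤? a)
        then sortDesc (map (λ x → x ∸ 2) pre ++ (a ∸ 2) ∷ (b ∸ 1) ∷ [])
        else pre ++ a ∷ b ∷ []                                -- not reached on P_ω

-- ψ⁻ : only meaningful for ℓ ≥ 2 (otherwise returns its input unchanged).
ψ⁻-rev : List ℕ → List ℕ → List ℕ
ψ⁻-rev lam (b ∷ a ∷ r) = ψ-step (reverse r) a b
ψ⁻-rev lam _ = lam

ψ⁻ : List ℕ → List ℕ
ψ⁻ lam = ψ⁻-rev lam (reverse lam)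

module Submission where

-- Write λ = pre ++ a ∷ b ∷ [], so a = λ_{ℓ-1} and b = λ_ℓ. Membership of λ in Pω says
-- that λ is nonincreasing, every part of pre exceeds b, b < a, and every odd part is at
-- most 2b+1. The rules of ψ⁻ split the pairs (a, b) with b < a into three shapes:
--   (i)   b = 0, a ≥ 2:      ψ⁻ lowers the last part of pre ++ [a]; the size drops by 1.
--   (ii)  a = b+1:           ψ⁻ lowers the last part of the nonincreasing rearrangement
--                            of pre ++ [2b+1]; the size drops by 1.
--   (iii) b ≥ 1, a ≥ b+2:    every part loses 2 except the last, which loses 1, and the
--                            result is sorted; the size drops by 2ℓ-1.
-- In (i) and (ii) membership in Pω comes from one fact: lowering the last part of a
-- nonincreasing list makes it the unique smallest part. In (iii) the smallest part b-1 is
-- still unique, hence it ends the sorted rearrangement. The odd-part bound survives since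
-- an odd part ≤ 2b+1 becomes ≤ 2(b-1)+1 after subtracting 2, while in case (i) the bound 1
-- forces every part ≥ 2 to be even.

open import Defs
open import Data.Nat using (ℕ; _≤_)
open import Data.Integer using (+_; _-_)
open import Data.List using (List; length)
open import Data.Product using (_×_)

open import Data.Nat using (zero; suc; _+_; _*_; _∸_; _<_; _≥_; s≤s; s≤s⁻¹; z≤n; _≟_; _≤?_)
open import Data.Nat.Properties
open import Data.Nat.Tactic.RingSolver using (solve-∀)
import Data.Integer as ℤ
import Data.Integer.Properties as ℤP
open import Data.List using ([]; _∷_; _++_; [_]; map; reverse)
open import Data.List.Properties using (++-assoc; ++-identityʳ; ++-conicalʳ; reverse-++; reverse-involutive; unfold-reverse)
open import Data.List.Reverse using ([]; _∶_∶ʳ_; reverseView)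
open import Data.Nat.ListAction.Properties using (sum-++; sum-↭)
import Data.List.Relation.Unary.All as All
open import Data.List.Relation.Unary.All using (All; []; _∷_)
open import Data.List.Relation.Unary.All.Properties using (++⁺; ++⁻ˡ; ++⁻ʳ; map⁺)
open import Data.List.Relation.Unary.Linked using (Linked; []; [-]; _∷_)
open import Data.List.Relation.Unary.AllPairs using (_∷_)
open import Data.List.Relation.Unary.Linked.Properties using (Linked⇒AllPairs)
import Data.List.Relation.Unary.Linked as Linked
open import Data.List.Relation.Binary.Permutation.Propositional using (_↭_; ↭-sym; ↭-trans)
open import Data.List.Relation.Binary.Permutation.Propositional.Properties
  using (All-resp-↭; ↭-reverse; ↭-empty-inv; drop-mid)
open import Data.List.Sort ≤-decTotalOrder using (sort-↭; sort-↗)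
open import Data.Product using (∃; ∃₂; _,_; proj₁; proj₂)
open import Data.Sum using (inj₁; inj₂)
open import Relation.Nullary.Decidable using (dec-true; dec-false)
open import Relation.Binary.PropositionalEquality using (_≡_; refl; sym; trans; cong; subst; module ≡-Reasoning)

odd-difference : ∀ {s t} n → s ≡ t + (1 + 2 * n) → OddInt (+ s - + t)
odd-difference {t = t} n refl = + n , (begin
    + (t + k) - + t            ≡⟨ ℤP.[+m]-[+n]≡m⊖n (t + k) t ⟩
    (t + k) ℤ.⊖ t              ≡⟨ ℤP.⊖-≥ (m≤m+n t k) ⟩
    + (t + k ∸ t)              ≡⟨ cong +_ (m+n∸m≡n t k) ⟩
    + (1 + 2 * n)              ≡⟨ ℤP.pos-+ 1 (2 * n) ⟩
    ℤ.1ℤ ℤ.+ + (2 * n)         ≡⟨ cong (λ z → ℤ.1ℤ ℤ.+ z) (ℤP.pos-* 2 n) ⟩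
    ℤ.1ℤ ℤ.+ + 2 ℤ.* + n       ∎)
  where
  open ≡-Reasoning
  k : ℕ
  k = 1 + 2 * n

OddBounded : ℕ → ℕ → Set
OddBounded m x = OddNat x → x ≤ 2 * m + 1

oddBounded-self : ∀ m → OddBounded m m
oddBounded-self m _ = ≤-trans (m≤m+n m (m + 0)) (m≤m+n _ 1)

oddBounded-mono : ∀ {m n x} → m ≤ n → OddBounded m x → OddBounded n x
oddBounded-mono m≤n bound odd = ≤-trans (bound odd) (+-monoˡ-≤ 1 (*-monoʳ-≤ 2 m≤n))

-- For m = 0 the bound says odd parts are ≤ 1; so a part ≥ 2 is even and meets every bound.
oddBounded-even : ∀ {m x} → 2 ≤ x → OddBounded 0 x → OddBounded m x
oddBounded-even 2≤x bound odd with ≤-trans 2≤x (bound odd)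
... | s≤s ()

-- Subtracting 2 from a part and 1 from the smallest part preserves the bound:
-- if x - 2 is odd then so is x, and x ≤ 2(m+1)+1 gives x - 2 ≤ 2m+1.
oddBounded-sub2 : ∀ {m x} → 2 ≤ x → OddBounded (suc m) x → OddBounded m (x ∸ 2)
oddBounded-sub2 {m} {suc (suc x)} _ bound (k , x≡1+2k) =
  s≤s⁻¹ (s≤s⁻¹ (subst (suc (suc x) ≤_) (cong (_+ 1) (*-suc 2 m)) (bound (suc k , x+2-odd))))
  where
  x+2-odd : suc (suc x) ≡ 1 + 2 * suc k
  x+2-odd = trans (cong (λ y → 2 + y) x≡1+2k) (cong suc (sym (*-suc 2 k)))

Nonincreasing : List ℕ → Set
Nonincreasing = Linked _≥_

last-minimum : ∀ xs {y} → Nonincreasing (xs ++ [ y ]) → All (y ≤_) xs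
last-minimum [] _ = []
last-minimum (x ∷ []) (y≤x ∷ [-]) = y≤x ∷ []
last-minimum (x ∷ x′ ∷ xs) (x′≤x ∷ desc) with last-minimum (x′ ∷ xs) desc
... | y≤x′ ∷ rest = ≤-trans y≤x′ x′≤x ∷ y≤x′ ∷ rest

lower-last : ∀ xs {y z} → z ≤ y → Nonincreasing (xs ++ [ y ]) → Nonincreasing (xs ++ [ z ])
lower-last [] _ _ = [-]
lower-last (x ∷ []) z≤y (y≤x ∷ [-]) = ≤-trans z≤y y≤x ∷ [-]
lower-last (x ∷ x′ ∷ xs) z≤y (x′≤x ∷ desc) = x′≤x ∷ lower-last (x′ ∷ xs) z≤y desc

drop-last : ∀ xs {a b} → Nonincreasing (xs ++ a ∷ b ∷ []) → Nonincreasing (xs ++ [ a ])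
drop-last [] _ = [-]
drop-last (x ∷ []) (a≤x ∷ _) = a≤x ∷ [-]
drop-last (x ∷ x′ ∷ xs) (x′≤x ∷ desc) = x′≤x ∷ drop-last (x′ ∷ xs) desc

append-minimum : ∀ ys {z} → Nonincreasing ys → All (z ≤_) ys → Nonincreasing (ys ++ [ z ])
append-minimum [] _ _ = [-]
append-minimum (y ∷ []) [-] (z≤y ∷ []) = z≤y ∷ [-]
append-minimum (y ∷ y′ ∷ ys) (y′≤y ∷ desc) (_ ∷ z≤ys) = y′≤y ∷ append-minimum (y′ ∷ ys) desc z≤ys

reverse-nondecreasing : ∀ xs → Linked _≤_ xs → Nonincreasing (reverse xs)
reverse-nondecreasing [] _ = []
reverse-nondecreasing (x ∷ xs) asc with Linked⇒AllPairs ≤-trans asc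
... | x≤xs ∷ _ =
  subst Nonincreasing (sym (unfold-reverse x xs))
    (append-minimum (reverse xs) (reverse-nondecreasing xs (Linked.tail asc))
       (All-resp-↭ (↭-sym (↭-reverse xs)) x≤xs))

sortDesc-nonincreasing : ∀ zs → Nonincreasing (sortDesc zs)
sortDesc-nonincreasing zs = reverse-nondecreasing _ (sort-↗ zs)

sortDesc-↭ : ∀ zs → sortDesc zs ↭ zs
sortDesc-↭ zs = ↭-trans (↭-reverse _) (sort-↭ zs)

snoc-form : ∀ {ys zs v} → ys ↭ zs ++ [ v ] → ∃₂ λ init (c : ℕ) → ys ≡ init ++ [ c ]
snoc-form {ys} {zs} perm with reverseView ys
... | init ∶ _ ∶ʳ c = init , c , refl
... | [] with ++-conicalʳ zs _ (↭-empty-inv (↭-sym perm))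
...   | ()

unique-minimum-last : ∀ {ys} xs m → Nonincreasing ys → ys ↭ xs ++ [ m ] → All (m <_) xs →
                      ∃ λ init → ys ≡ init ++ [ m ] × init ↭ xs
unique-minimum-last xs m desc perm above with snoc-form perm
... | init , c , refl with ≤-antisym c≤m m≤c
  where
  c≤m : c ≤ m
  c≤m = All.head (++⁻ʳ xs (All-resp-↭ perm (++⁺ (last-minimum init desc) (≤-refl ∷ []))))
  m≤c : m ≤ c
  m≤c = All.head (++⁻ʳ init (All-resp-↭ (↭-sym perm) (++⁺ (All.map <⇒≤ above) (≤-refl ∷ []))))
... | refl = init , refl , subst (_↭ xs) (++-identityʳ init)
                             (subst (init ++ [] ↭_) (++-identityʳ xs) (drop-mid init xs perm))

lowerLast-Pω : ∀ pre c → Nonincreasing (pre ++ [ suc c ]) → All (OddBounded c) pre → Pω (pre ++ [ c ])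
lowerLast-Pω pre c desc bounds =
  pre , c , refl , lower-last pre (n≤1+n c) desc , last-minimum pre desc , ++⁺ bounds (oddBounded-self c ∷ [])

rearrangement-Pω : ∀ {ys} xs m → Nonincreasing ys → ys ↭ xs ++ [ m ] → All (m <_) xs →
                   All (OddBounded m) (xs ++ [ m ]) → Pω ys
rearrangement-Pω xs m desc perm above bounds with unique-minimum-last xs m desc perm above
... | init , refl , init↭xs =
  init , m , refl , desc , All-resp-↭ (↭-sym init↭xs) above , All-resp-↭ (↭-sym perm) bounds

size-snoc : ∀ xs x → size (xs ++ [ x ]) ≡ size xs + x
size-snoc xs x = trans (sum-++ xs [ x ]) (cong (λ y → size xs + y) (+-identityʳ x))

size-pair : ∀ xs a b → size (xs ++ a ∷ b ∷ []) ≡ size xs + (a + b)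
size-pair xs a b = trans (sum-++ xs _) (cong (λ z → size xs + (a + z)) (+-identityʳ b))

size-lower : ∀ xs c → size (xs ++ [ suc c ]) ≡ size (xs ++ [ c ]) + 1
size-lower xs c = begin
  size (xs ++ [ suc c ])   ≡⟨ size-snoc xs (suc c) ⟩
  size xs + suc c          ≡⟨ +-suc (size xs) c ⟩
  suc (size xs + c)        ≡⟨ +-comm 1 _ ⟩
  size xs + c + 1          ≡⟨ cong (_+ 1) (size-snoc xs c) ⟨
  size (xs ++ [ c ]) + 1   ∎
  where open ≡-Reasoning

size-sub2 : ∀ xs → All (2 ≤_) xs → size xs ≡ 2 * length xs + size (map (_∸ 2) xs)
size-sub2 [] [] = refl
size-sub2 (suc (suc x) ∷ xs) (s≤s (s≤s _) ∷ xs≥2) rewrite size-sub2 xs xs≥2 =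
  regroup x (length xs) (size (map (_∸ 2) xs))
  where
  regroup : ∀ x n s → suc (suc x) + (2 * n + s) ≡ 2 * suc n + (x + s)
  regroup = solve-∀

decLast-snoc : ∀ xs x → decLast (xs ++ [ x ]) ≡ xs ++ [ x ∸ 1 ]
decLast-snoc [] x = refl
decLast-snoc (y ∷ []) x = refl
decLast-snoc (y ∷ y′ ∷ xs) x = cong (y ∷_) (decLast-snoc (y′ ∷ xs) x)

lowerLast-rearrangement : ∀ {b ys} zs v → Nonincreasing ys → ys ↭ zs ++ [ v ] →
                          All (λ x → b < x × OddBounded b x) (zs ++ [ v ]) →
                          size ys ≡ size (decLast ys) + 1 × Pω (decLast ys)
lowerLast-rearrangement {b} zs v desc perm parts with snoc-form perm
... | init , c , refl with ++⁻ˡ init parts′ | All.head (++⁻ʳ init parts′)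
  where
  parts′ : All (λ x → b < x × OddBounded b x) (init ++ [ c ])
  parts′ = All-resp-↭ (↭-sym perm) parts
... | init-parts | s≤s b≤c′ , _ rewrite decLast-snoc init c =
  size-lower init _ , lowerLast-Pω init _ desc (All.map (λ (_ , bound) → oddBounded-mono b≤c′ bound) init-parts)

Conclusion : List ℕ → List ℕ → Set
Conclusion lam mu = OddInt (+ size lam - + size mu) × Pω mu

case-i : ∀ pre a′ → Nonincreasing (pre ++ suc (suc a′) ∷ 0 ∷ []) → All (OddBounded 0) pre →
         Conclusion (pre ++ suc (suc a′) ∷ 0 ∷ []) (pre ++ [ suc a′ ])
case-i pre a′ desc bounds =
  odd-difference 0 size-drop , lowerLast-Pω pre (suc a′) desc′ (All.zipWith even-part (pre≥2 , bounds))
  where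
  desc′ : Nonincreasing (pre ++ [ suc (suc a′) ])
  desc′ = drop-last pre desc
  pre≥2 : All (2 ≤_) pre
  pre≥2 = All.map (≤-trans (s≤s (s≤s z≤n))) (last-minimum pre desc′)
  even-part : ∀ {x} → 2 ≤ x × OddBounded 0 x → OddBounded (suc a′) x
  even-part (2≤x , bound) = oddBounded-even {suc a′} 2≤x bound
  size-drop : size (pre ++ suc (suc a′) ∷ 0 ∷ []) ≡ size (pre ++ [ suc a′ ]) + 1
  size-drop = begin
    size (pre ++ suc (suc a′) ∷ 0 ∷ [])   ≡⟨ size-pair pre _ 0 ⟩
    size pre + (suc (suc a′) + 0)        ≡⟨ cong (λ y → size pre + y) (+-identityʳ _) ⟩
    size pre + suc (suc a′)              ≡⟨ size-snoc pre _ ⟨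
    size (pre ++ [ suc (suc a′) ])       ≡⟨ size-lower pre (suc a′) ⟩
    size (pre ++ [ suc a′ ]) + 1         ∎
    where open ≡-Reasoning

-- Case (ii): a = b+1; the last part of the sorted rearrangement of pre ++ [2b+1] is lowered.
-- All its parts exceed b and meet the odd-part bound for b (the new part is 2b+1 itself).
case-ii : ∀ pre b → All (b <_) pre → All (OddBounded b) pre →
          Conclusion (pre ++ suc b ∷ b ∷ []) (decLast (sortDesc (pre ++ [ suc b + b ])))
case-ii pre b above bounds = odd-difference 0 (trans size-merge (proj₁ lowered)) , proj₂ lowered
  where
  merged : List ℕ
  merged = pre ++ [ suc b + b ]
  2b+1 : ∀ n → suc n + n ≡ 2 * n + 1
  2b+1 = solve-∀
  merged-parts : All (λ x → b < x × OddBounded b x) merged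
  merged-parts = ++⁺ (All.zip (above , bounds)) ((s≤s (m≤m+n b b) , λ _ → ≤-reflexive (2b+1 b)) ∷ [])
  lowered : size (sortDesc merged) ≡ size (decLast (sortDesc merged)) + 1 × Pω (decLast (sortDesc merged))
  lowered = lowerLast-rearrangement pre (suc b + b) (sortDesc-nonincreasing merged) (sortDesc-↭ merged) merged-parts
  size-merge : size (pre ++ suc b ∷ b ∷ []) ≡ size (sortDesc merged)
  size-merge = begin
    size (pre ++ suc b ∷ b ∷ [])   ≡⟨ size-pair pre (suc b) b ⟩
    size pre + (suc b + b)        ≡⟨ size-snoc pre _ ⟨
    size merged                   ≡⟨ sum-↭ (sortDesc-↭ merged) ⟨
    size (sortDesc merged)        ∎
    where open ≡-Reasoning

-- The new smallest part b′ is still unique, and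
-- the odd-part bound moves from b to b′ = b - 1.
case-iii : ∀ pre a′ b′ → b′ < a′ → Nonincreasing (pre ++ suc (suc a′) ∷ suc b′ ∷ []) →
           All (OddBounded (suc b′)) pre → OddBounded (suc b′) (suc (suc a′)) →
           Conclusion (pre ++ suc (suc a′) ∷ suc b′ ∷ []) (sortDesc (map (_∸ 2) pre ++ a′ ∷ b′ ∷ []))
case-iii pre a′ b′ b′<a′ desc pre-bounds a-bound =
  odd-difference (suc (length pre)) size-drop ,
  rearrangement-Pω shifted b′ (sortDesc-nonincreasing lowered) perm above bounds
  where
  lowered shifted : List ℕ
  lowered = map (_∸ 2) pre ++ a′ ∷ b′ ∷ []
  shifted = map (_∸ 2) pre ++ [ a′ ]
  perm : sortDesc lowered ↭ shifted ++ [ b′ ]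
  perm = subst (sortDesc lowered ↭_) (sym (++-assoc (map (_∸ 2) pre) [ a′ ] [ b′ ])) (sortDesc-↭ lowered)
  pre≥a : All (suc (suc a′) ≤_) pre
  pre≥a = last-minimum pre (drop-last pre desc)
  pre≥2 : All (2 ≤_) pre
  pre≥2 = All.map (≤-trans (s≤s (s≤s z≤n))) pre≥a
  above : All (b′ <_) shifted
  above = ++⁺ (map⁺ (All.map (λ a≤x → <-≤-trans b′<a′ (∸-monoˡ-≤ 2 a≤x)) pre≥a)) (b′<a′ ∷ [])
  bounds : All (OddBounded b′) (shifted ++ [ b′ ])
  bounds = ++⁺ (++⁺ (map⁺ (All.zipWith (λ (x≥2 , bound) → oddBounded-sub2 x≥2 bound) (pre≥2 , pre-bounds)))
                    (oddBounded-sub2 (s≤s (s≤s z≤n)) a-bound ∷ []))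
               (oddBounded-self b′ ∷ [])
  regroup : ∀ l s a b → (2 * l + s) + (suc (suc a) + suc b) ≡ (s + (a + b)) + (1 + 2 * suc l)
  regroup = solve-∀
  size-drop : size (pre ++ suc (suc a′) ∷ suc b′ ∷ []) ≡ size (sortDesc lowered) + (1 + 2 * suc (length pre))
  size-drop = begin
    size (pre ++ suc (suc a′) ∷ suc b′ ∷ [])                         ≡⟨ size-pair pre _ _ ⟩
    size pre + (suc (suc a′) + suc b′)                               ≡⟨ cong (_+ _) (size-sub2 pre pre≥2) ⟩
    (2 * length pre + size (map (_∸ 2) pre)) + (suc (suc a′) + suc b′) ≡⟨ regroup (length pre) _ a′ b′ ⟩
    (size (map (_∸ 2) pre) + (a′ + b′)) + (1 + 2 * suc (length pre))  ≡⟨ cong (_+ _) (size-pair (map (_∸ 2) pre) a′ b′) ⟨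
    size lowered + (1 + 2 * suc (length pre))                        ≡⟨ cong (_+ _) (sum-↭ (sortDesc-↭ lowered)) ⟨
    size (sortDesc lowered) + (1 + 2 * suc (length pre))             ∎
    where open ≡-Reasoning

ψ⁻-last-two : ∀ pre a b → ψ⁻ (pre ++ a ∷ b ∷ []) ≡ ψ-step pre a b
ψ⁻-last-two pre a b = begin
  ψ⁻-rev lam (reverse lam)             ≡⟨ cong (ψ⁻-rev lam) (reverse-++ pre (a ∷ b ∷ [])) ⟩
  ψ-step (reverse (reverse pre)) a b   ≡⟨ cong (λ r → ψ-step r a b) (reverse-involutive pre) ⟩
  ψ-step pre a b                       ∎
  where
  open ≡-Reasoning
  lam : List ℕ
  lam = pre ++ a ∷ b ∷ []

data Shape : ℕ → ℕ → Set where
  shape-i   : ∀ a′ → Shape (suc (suc a′)) 0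
  shape-ii  : ∀ b → Shape (suc b) b
  shape-iii : ∀ a′ b′ → b′ < a′ → Shape (suc (suc a′)) (suc b′)

shape : ∀ a b → b < a → Shape a b
shape (suc zero) zero _ = shape-ii 0
shape (suc (suc a′)) zero _ = shape-i a′
shape (suc zero) (suc b′) (s≤s ())
shape (suc (suc a′)) (suc b′) (s≤s (s≤s b′≤a′)) with m≤n⇒m<n∨m≡n b′≤a′
... | inj₁ b′<a′ = shape-iii a′ b′ b′<a′
... | inj₂ refl = shape-ii (suc b′)

ψ-step-ii : ∀ pre b → ψ-step pre (suc b) b ≡ decLast (sortDesc (pre ++ [ suc b + b ]))
ψ-step-ii pre zero = refl
ψ-step-ii pre (suc b) rewrite dec-true (suc (suc b) ≟ suc (suc b)) refl = refl

ψ-step-iii : ∀ pre a′ b′ → b′ < a′ →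
             ψ-step pre (suc (suc a′)) (suc b′) ≡ sortDesc (map (_∸ 2) pre ++ a′ ∷ b′ ∷ [])
ψ-step-iii pre a′ b′ b′<a′
  rewrite dec-false (suc (suc a′) ≟ suc (suc b′)) (λ eq → <⇒≢ b′<a′ (sym (suc-injective (suc-injective eq))))
        | dec-true (suc b′ + 2 ≤? suc (suc a′)) (subst (_≤ suc (suc a′)) (+-comm 2 (suc b′)) (s≤s (s≤s b′<a′)))
  = refl

ψ-step-correct : ∀ pre a b → Nonincreasing (pre ++ a ∷ b ∷ []) → All (b <_) pre → b < a →
                 All (OddBounded b) pre → OddBounded b a →
                 Conclusion (pre ++ a ∷ b ∷ []) (ψ-step pre a b)
ψ-step-correct pre a b desc above b<a pre-bounds a-bound with shape a b b<a
... | shape-i a′ = case-i pre a′ desc pre-bounds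
... | shape-ii _ = subst (Conclusion lam) (sym (ψ-step-ii pre b)) (case-ii pre b above pre-bounds)
  where
  lam : List ℕ
  lam = pre ++ suc b ∷ b ∷ []
... | shape-iii a′ b′ b′<a′ =
  subst (Conclusion lam) (sym (ψ-step-iii pre a′ b′ b′<a′)) (case-iii pre a′ b′ b′<a′ desc pre-bounds a-bound)
  where
  lam : List ℕ
  lam = pre ++ suc (suc a′) ∷ suc b′ ∷ []

lemma1 : (λ′ : List ℕ) → Pω λ′ → 2 ≤ length λ′ →
         OddInt ((+ size λ′) - (+ size (ψ⁻ λ′))) × Pω (ψ⁻ λ′)
lemma1 _ (pre₀ , b , refl , desc , above , bounds) len with reverseView pre₀
lemma1 _ (_ , b , refl , _ , _ , _) (s≤s ()) | []
lemma1 _ (_ , b , refl , desc , above , bounds) _ | pre ∶ _ ∶ʳ a =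
  subst (λ lam → Conclusion lam (ψ⁻ lam)) (sym regroup)
    (subst (Conclusion (pre ++ a ∷ b ∷ [])) (sym (ψ⁻-last-two pre a b))
      (ψ-step-correct pre a b (subst Nonincreasing regroup desc) (++⁻ˡ pre above) b<a
                      (++⁻ˡ pre init-bounds) (All.head (++⁻ʳ pre init-bounds))))
  where
  regroup : (pre ++ [ a ]) ++ [ b ] ≡ pre ++ a ∷ b ∷ []
  regroup = ++-assoc pre [ a ] [ b ]
  b<a : b < a
  b<a = All.head (++⁻ʳ pre above)
  init-bounds : All (OddBounded b) (pre ++ [ a ])
  init-bounds = ++⁻ˡ (pre ++ [ a ]) bounds
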